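{- Let $k\geq 2$, let $G$ be an $n$-vertex linear $k$-uniform hypergraph and let $\lambda=\lceil \log n\rceil$. Then $G$ contains a $2\lambda^k$-balanced $k$-partite subhypergraph with at least $e(G)k!/(k\lambda)^k$ edges.
   Context: A hypergraph is linear if any two distinct edges intersect in at most one vertex. A $k$-partite $k$-uniform hypergraph $G$ with parts $X_1,\dots,X_k$ (every edge has exactly one vertex in each part) is $\mu$-balanced if for each $1\leq i\leq k$, $\max_{w\in X_i} d_G(w)\leq \mu e(G)/|X_i|$. $\log$ is the natural logarithm. -}

module Defs where

open import Data.Nat using (ℕ; zero; suc; _+_; _*_; _^_; _≤_; _<_; _/_; _!)
open import Data.Nat.Properties using (_!≢0)
open import Data.Fin using (Fin)
open import Data.Fin.Subset using (Subset; _∈_; _∩_; ∣_∣; Empty)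
open import Data.Fin.Subset.Properties using (_∈?_)
open import Data.Vec using (tabulate)
open import Data.Product using (∃; _×_)
open import Relation.Nullary using (¬_; does)
open import Relation.Binary.PropositionalEquality using (_≡_; _≢_)

-- Ceiling of the natural logarithm, without real numbers.
-- expPartial λ m = m! * Σ_{j=0}^{m} λ^j / j!   (an exact natural number)
sumUpTo : (ℕ → ℕ) → ℕ → ℕ
sumUpTo f zero    = f zero
sumUpTo f (suc m) = sumUpTo f m + f (suc m)

expPartialScaled : ℕ → ℕ → ℕ
expPartialScaled λ′ m = sumUpTo (λ j → λ′ ^ j * (_/_ (m !) (j !) {{j !≢0}})) m

-- n ≤ e^λ  (as real numbers)  iff some partial sum of the exponential
-- series of e^λ is ≥ n.
ExpAtLeast : ℕ → ℕ → Set
ExpAtLeast n λ′ = ∃ λ m → n * m ! ≤ expPartialScaled λ′ m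

IsCeilLog : ℕ → ℕ → Set
IsCeilLog n λ′ = ExpAtLeast n λ′ × (∀ μ → μ < λ′ → ¬ ExpAtLeast n μ)

DistinctEdges : ∀ {n m} → (Fin m → Subset n) → Set
DistinctEdges edge = ∀ i j → edge i ≡ edge j → i ≡ j

Uniform : ∀ {n m} → ℕ → (Fin m → Subset n) → Set
Uniform k edge = ∀ i → ∣ edge i ∣ ≡ k

Linear : ∀ {n m} → (Fin m → Subset n) → Set
Linear edge = ∀ i j → i ≢ j → ∣ edge i ∩ edge j ∣ ≤ 1

degree : ∀ {n m} → (Fin m → Subset n) → Subset m → Fin n → ℕ
degree edge S w = ∣ S ∩ tabulate (λ i → does (w ∈? edge i)) ∣

IsPartite : ∀ {n m} k → (Fin m → Subset n) → Subset m → (Fin k → Subset n) → Set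
IsPartite k edge S X =
  (∀ a b → a ≢ b → Empty (X a ∩ X b)) ×
  (∀ i → i ∈ S → ∀ a → ∣ edge i ∩ X a ∣ ≡ 1)

-- μ-balanced: for every part X a and w ∈ X a, d(w) ≤ μ e(H) / |X a|,
-- written multiplicatively (μ is a natural number here).
Balanced : ∀ {n m} k → ℕ → (Fin m → Subset n) → Subset m → (Fin k → Subset n) → Set
Balanced k μ edge S X = ∀ a w → w ∈ X a → degree edge S w * ∣ X a ∣ ≤ μ * ∣ S ∣

module Submission where

-- Colour the vertices with k colours. Averaging over all k ^ n colourings gives one for which a
-- k! / k ^ k fraction of the edges is rainbow (one vertex of each colour); keep only those edges.
-- Linearity bounds every degree by n ≤ e ^ λ ≤ (2λ) ^ λ, so the degrees fall into λ ranges
-- [r ^ β, r ^ (β + 1)) with r = 2λ. Treat the colour classes one at a time: keep the vertices of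
-- the class whose current degree lies in the range met by the most edges, and the edges meeting
-- them. A round keeps a 1/λ fraction of the edges and makes the new part r-balanced: its vertices
-- have degree below r ^ (β + 1), and there are at most (number of edges) / r ^ β of them since every
-- kept edge meets the part once. Later rounds only delete edges, which weakens the balance of the
-- part by at most λ ^ (k - 1).

open import Data.Bool.Base using (Bool; true; false; _∧_; not; if_then_else_)
open import Data.Bool.Properties using (T-≡)
open import Data.Empty using (⊥-elim)
open import Data.Fin.Base using (Fin; zero; suc; toℕ; inject₁; fromℕ)
import Data.Fin.Properties as Fin
open import Data.Fin.Subset using (Subset; _∈_; _∩_; ∣_∣; Empty; ⊥)
open import Data.Fin.Subset.Properties using (_∈?_; x∈p∩q⁻; ∉⊥; ∣p∣≤n)
open import Data.Nat
open import Data.Nat.Properties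
open import Data.Nat.DivMod using (*-/-assoc; n/n≡1)
open import Data.Nat.Divisibility using (m≤n⇒m!∣n!)
open import Data.Nat.Tactic.RingSolver using (solve-∀)
open import Data.Product using (∃; ∃₂; _×_; _,_; proj₁; proj₂)
open import Data.Vec.Base as Vec using ([]; lookup; tabulate)
open import Data.Vec.Properties using (lookup∘tabulate; lookup-zipWith; []=⇒lookup)
open import Data.Vec.Functional using (_∷_)
open import Function.Base using (_∘_; const; id)
open import Function.Bundles using (Equivalence)
open import Relation.Nullary using (does; yes; no)
open import Relation.Binary.PropositionalEquality
open import Algebra.Properties.CommutativeSemigroup *-commutativeSemigroup
  using (x∙yz≈y∙xz; xy∙z≈xz∙y; xy∙z≈y∙zx; interchange)
open import Algebra.Properties.Semiring.Sum +-*-semiring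
  using (sum; sum-syntax; sum-cong-≗; ∑-comm; ∑-distrib-+; *-distribˡ-sum; *-distribʳ-sum)

open import Defs

sum-mono-≤ : ∀ {n} {f g : Fin n → ℕ} → (∀ i → f i ≤ g i) → sum f ≤ sum g
sum-mono-≤ {zero}  f≤g = z≤n
sum-mono-≤ {suc n} f≤g = +-mono-≤ (f≤g zero) (sum-mono-≤ (f≤g ∘ suc))

sum-mono-< : ∀ {n} {f g : Fin n → ℕ} → (∀ i → f i ≤ g i) → ∀ j → f j < g j → sum f < sum g
sum-mono-< f≤g zero    fj<gj = +-mono-<-≤ fj<gj (sum-mono-≤ (f≤g ∘ suc))
sum-mono-< f≤g (suc j) fj<gj = +-mono-≤-< (f≤g zero) (sum-mono-< (f≤g ∘ suc) j fj<gj)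

≤-sum : ∀ {n} (f : Fin n → ℕ) i → f i ≤ sum f
≤-sum f zero    = m≤m+n _ _
≤-sum f (suc i) = ≤-trans (≤-sum (f ∘ suc) i) (m≤n+m _ (f zero))

sum-const : ∀ n c → ∑[ i < n ] c ≡ n * c
sum-const zero    c = refl
sum-const (suc n) c = cong (c +_) (sum-const n c)

∃-≥-average : ∀ n (f : Fin (suc n) → ℕ) → ∃ λ i → sum f ≤ suc n * f i
∃-≥-average zero    f = zero , ≤-refl
∃-≥-average (suc n) f with ∃-≥-average n (f ∘ suc)
... | i , avg with f (suc i) ≤? f zero
... | yes fi≤f0 = zero , +-monoʳ-≤ (f zero) (≤-trans avg (*-monoʳ-≤ (suc n) fi≤f0))
... | no  fi≰f0 = suc i , +-mono-≤ (<⇒≤ (≰⇒> fi≰f0)) avg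

⟦_⟧ : Bool → ℕ
⟦ true  ⟧ = 1
⟦ false ⟧ = 0

⟦⟧≤1 : ∀ b → ⟦ b ⟧ ≤ 1
⟦⟧≤1 true  = ≤-refl
⟦⟧≤1 false = z≤n

⟦⟧≤-intro : ∀ b {x} → (b ≡ true → 1 ≤ x) → ⟦ b ⟧ ≤ x
⟦⟧≤-intro true  1≤x = 1≤x refl
⟦⟧≤-intro false 1≤x = z≤n

count : ∀ {n} → (Fin n → Bool) → ℕ
count p = sum (⟦_⟧ ∘ p)

_⊆_ : ∀ {n} → (Fin n → Bool) → (Fin n → Bool) → Set
p ⊆ q = ∀ i → p i ≡ true → q i ≡ true

count-all : ∀ n → count (const {B = Fin n} true) ≡ n
count-all n = trans (sum-const n 1) (*-identityʳ n)

count-mono : ∀ {n} {p q : Fin n → Bool} → p ⊆ q → count p ≤ count q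
count-mono {p = p} {q} p⊆q = sum-mono-≤ pointwise
  where
  pointwise : ∀ i → ⟦ p i ⟧ ≤ ⟦ q i ⟧
  pointwise i with p i in pi
  ... | false = z≤n
  ... | true  rewrite p⊆q i pi = ≤-refl

holds⇒count≥1 : ∀ {n} (p : Fin n → Bool) i → p i ≡ true → 1 ≤ count p
holds⇒count≥1 p i pi = ≤-trans (≤-reflexive (cong ⟦_⟧ (sym pi))) (≤-sum (⟦_⟧ ∘ p) i)

count≥1⇒holds : ∀ {n} (p : Fin n → Bool) → 1 ≤ count p → ∃ λ i → p i ≡ true
count≥1⇒holds {suc n} p 1≤count with p zero in p0
... | true  = zero , p0
... | false = let i , pi = count≥1⇒holds (p ∘ suc) 1≤count in suc i , pi

count≤1 : ∀ {n} (p : Fin n → Bool) → (∀ i j → p i ≡ true → p j ≡ true → i ≡ j) → count p ≤ 1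
count≤1 {zero}  p unique = z≤n
count≤1 {suc n} p unique with p zero in p0
... | false = count≤1 (p ∘ suc) (λ i j pi pj → Fin.suc-injective (unique (suc i) (suc j) pi pj))
... | true  = s≤s (≤-reflexive (trans (sum-cong-≗ absent) (trans (sum-const n 0) (*-zeroʳ n))))
  where
  absent : ∀ i → ⟦ p (suc i) ⟧ ≡ 0
  absent i with p (suc i) in pi
  ... | false = refl
  ... | true  with unique zero (suc i) p0 pi
  ... | ()

count≡1 : ∀ {n} (p : Fin n → Bool) x → p x ≡ true → (∀ i j → p i ≡ true → p j ≡ true → i ≡ j) →
          count p ≡ 1
count≡1 p x px unique = ≤-antisym (count≤1 p unique) (holds⇒count≥1 p x px)

⟦∧⟧ : ∀ a b → ⟦ a ∧ b ⟧ ≡ ⟦ a ⟧ * ⟦ b ⟧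
⟦∧⟧ true  b = sym (+-identityʳ _)
⟦∧⟧ false b = refl

∧-true⇒ : ∀ {a b} → a ∧ b ≡ true → a ≡ true × b ≡ true
∧-true⇒ {true} {true} _ = refl , refl

count-split : ∀ {n} (p q : Fin n → Bool) →
              count p ≡ count (λ i → p i ∧ q i) + count (λ i → p i ∧ not (q i))
count-split p q = trans (sum-cong-≗ (λ i → split (p i) (q i)))
                        (∑-distrib-+ (λ i → ⟦ p i ∧ q i ⟧) (λ i → ⟦ p i ∧ not (q i) ⟧))
  where
  split : ∀ a b → ⟦ a ⟧ ≡ ⟦ a ∧ b ⟧ + ⟦ a ∧ not b ⟧
  split true  true  = refl
  split true  false = refl
  split false b     = refl

sum≡size⇒all≡1 : ∀ {n} (f : Fin n → ℕ) → (∀ i → f i ≤ 1) → sum f ≡ n → ∀ i → f i ≡ 1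
sum≡size⇒all≡1 {n} f f≤1 sum≡n i with f i ≟ 1
... | yes fi≡1 = fi≡1
... | no  fi≢1 = ⊥-elim (<-irrefl (trans sum≡n (sym (count-all n)))
                                  (sum-mono-< f≤1 i (≤∧≢⇒< (f≤1 i) fi≢1)))

_==_ : ∀ {k} → Fin k → Fin k → Bool
a == b = does (a Fin.≟ b)

==⇒≡ : ∀ {k} {a b : Fin k} → a == b ≡ true → a ≡ b
==⇒≡ {a = a} {b} eq with a Fin.≟ b
... | yes a≡b = a≡b

==-refl : ∀ {k} (a : Fin k) → a == a ≡ true
==-refl a with a Fin.≟ a
... | yes _   = refl
... | no  a≢a = ⊥-elim (a≢a refl)

count-==ˡ : ∀ {k} (x : Fin k) → count (_== x) ≡ 1
count-==ˡ x = count≡1 (_== x) x (==-refl x) (λ i j i≡x j≡x → trans (==⇒≡ i≡x) (sym (==⇒≡ j≡x)))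

count-==ʳ : ∀ {k} (x : Fin k) → count (x ==_) ≡ 1
count-==ʳ x = count≡1 (x ==_) x (==-refl x) (λ i j x≡i x≡j → trans (sym (==⇒≡ {a = x} x≡i)) (==⇒≡ {a = x} x≡j))

count-∧-== : ∀ {n} (p : Fin n → Bool) x → p x ≡ true → count (λ i → p i ∧ i == x) ≡ 1
count-∧-== p x px = count≡1 _ x (cong₂ _∧_ px (==-refl x))
  (λ i j i≡x j≡x → trans (==⇒≡ (proj₂ (∧-true⇒ i≡x))) (sym (==⇒≡ (proj₂ (∧-true⇒ {p j} j≡x)))))

≢⇒not== : ∀ {k} {a b : Fin k} → a ≢ b → not (a == b) ≡ true
≢⇒not== {a = a} {b} a≢b with a Fin.≟ b
... | yes a≡b = ⊥-elim (a≢b a≡b)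
... | no  _   = refl

count≥2 : ∀ {n} (p : Fin n → Bool) x y → p x ≡ true → p y ≡ true → x ≢ y → 2 ≤ count p
count≥2 p x y px py x≢y = begin
  1 + 1                                                      ≤⟨ +-mono-≤ (≤-reflexive (sym (count-∧-== p x px))) others ⟩
  count (λ i → p i ∧ i == x) + count (λ i → p i ∧ not (i == x)) ≡⟨ count-split p (_== x) ⟨
  count p                                                    ∎
  where
  open ≤-Reasoning
  others : 1 ≤ count (λ i → p i ∧ not (i == x))
  others = holds⇒count≥1 _ y (cong₂ _∧_ py (≢⇒not== (x≢y ∘ sym)))

-- Rainbow colourings

∑ᶜ : ∀ {k} n → ((Fin n → Fin k) → ℕ) → ℕ
∑ᶜ zero    F = F (λ ())
∑ᶜ (suc n) F = sum (λ a → ∑ᶜ n (λ c → F (a ∷ c)))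

∑ᶜ-cong : ∀ {k} n {F G : (Fin n → Fin k) → ℕ} → (∀ c → F c ≡ G c) → ∑ᶜ n F ≡ ∑ᶜ n G
∑ᶜ-cong zero    F≡G = F≡G _
∑ᶜ-cong (suc n) F≡G = sum-cong-≗ (λ a → ∑ᶜ-cong n (λ c → F≡G (a ∷ c)))

∑ᶜ-comm : ∀ {k m} n (F : (Fin n → Fin k) → Fin m → ℕ) →
          ∑ᶜ n (λ c → sum (F c)) ≡ sum (λ i → ∑ᶜ n (λ c → F c i))
∑ᶜ-comm zero    F = refl
∑ᶜ-comm (suc n) F = trans (sum-cong-≗ (λ a → ∑ᶜ-comm n (λ c → F (a ∷ c))))
                          (∑-comm (λ a i → ∑ᶜ n (λ c → F (a ∷ c) i)))

∑ᶜ-*ˡ : ∀ {k} n t (F : (Fin n → Fin k) → ℕ) → ∑ᶜ n (λ c → t * F c) ≡ t * ∑ᶜ n F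
∑ᶜ-*ˡ zero    t F = refl
∑ᶜ-*ˡ (suc n) t F = trans (sum-cong-≗ (λ a → ∑ᶜ-*ˡ n t (λ c → F (a ∷ c))))
                          (sym (*-distribˡ-sum t (λ a → ∑ᶜ n (λ c → F (a ∷ c)))))

∃-≥-averageᶜ : ∀ {k} n (F : (Fin n → Fin (suc k)) → ℕ) → ∃ λ c → ∑ᶜ n F ≤ suc k ^ n * F c
∃-≥-averageᶜ zero    F = (λ ()) , ≤-reflexive (sym (+-identityʳ _))
∃-≥-averageᶜ {k} (suc n) F = best ∷ colouring best , (begin
    sum (λ a → ∑ᶜ n (λ c → F (a ∷ c)))
  ≤⟨ sum-mono-≤ (λ a → proj₂ (∃-≥-averageᶜ n (λ c → F (a ∷ c)))) ⟩
    sum (λ a → K ^ n * value a)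
  ≡⟨ *-distribˡ-sum (K ^ n) value ⟨
    K ^ n * sum value
  ≤⟨ *-monoʳ-≤ (K ^ n) (proj₂ (∃-≥-average k value)) ⟩
    K ^ n * (K * value best)
  ≡⟨ *-assoc (K ^ n) K (value best) ⟨
    K ^ n * K * value best
  ≡⟨ cong (_* value best) (*-comm (K ^ n) K) ⟩
    K * K ^ n * value best
  ∎)
  where
  open ≤-Reasoning
  K = suc k
  colouring : Fin K → Fin n → Fin K
  colouring a = proj₁ (∃-≥-averageᶜ n (λ c → F (a ∷ c)))
  value : Fin K → ℕ
  value a = F (a ∷ colouring a)
  best = proj₁ (∃-≥-average k value)

remove : ∀ {k} → (Fin k → Bool) → Fin k → Fin k → Bool
remove A x y = A y ∧ not (y == x)

count-remove : ∀ {k} (A : Fin k → Bool) x → A x ≡ true → suc (count (remove A x)) ≡ count A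
count-remove A x Ax = sym (trans (count-split A (_== x)) (cong (_+ count (remove A x)) (count-∧-== A x Ax)))

injectiveInto : ∀ {k n} → (Fin n → Bool) → (Fin k → Bool) → (Fin n → Fin k) → Bool
injectiveInto {n = zero}  e A c = true
injectiveInto {n = suc n} e A c =
  if e zero then A (c zero) ∧ injectiveInto (e ∘ suc) (remove A (c zero)) (c ∘ suc)
            else injectiveInto (e ∘ suc) A (c ∘ suc)

falling : ℕ → ℕ → ℕ
falling a zero    = 1
falling a (suc j) = a * falling (a ∸ 1) j

falling-self : ∀ n → falling n n ≡ n !
falling-self zero    = refl
falling-self (suc n) = cong (suc n *_) (falling-self n)

-- There are k ^ (n ∸ count e) * falling (count A) (count e) such colourings; the count is
-- multiplied by k ^ count e to avoid the truncated subtraction.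
∑ᶜ-injectiveInto : ∀ {k} n (e : Fin n → Bool) (A : Fin k → Bool) →
  ∑ᶜ n (λ c → ⟦ injectiveInto e A c ⟧) * k ^ count e ≡ k ^ n * falling (count A) (count e)
∑ᶜ-injectiveInto zero e A = refl
∑ᶜ-injectiveInto {k} (suc n) e A with e zero
... | false = begin
    (∑[ _ < k ] N) * k ^ count e′  ≡⟨ cong (_* k ^ count e′) (sum-const k N) ⟩
    k * N * k ^ count e′           ≡⟨ *-assoc k N _ ⟩
    k * (N * k ^ count e′)         ≡⟨ cong (k *_) (∑ᶜ-injectiveInto n e′ A) ⟩
    k * (k ^ n * falling (count A) (count e′)) ≡⟨ *-assoc k _ _ ⟨
    k * k ^ n * falling (count A) (count e′)   ∎
  where
  open ≡-Reasoning
  e′ = e ∘ suc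
  N = ∑ᶜ n (λ c → ⟦ injectiveInto e′ A c ⟧)
... | true = begin
    sum (λ a → ∑ᶜ n (λ c → ⟦ A a ∧ injectiveInto e′ (remove A a) c ⟧)) * (k * k ^ count e′)
      ≡⟨ cong (_* (k * k ^ count e′)) (sum-cong-≗ λ a →
           trans (∑ᶜ-cong n (λ c → ⟦∧⟧ (A a) _)) (∑ᶜ-*ˡ n ⟦ A a ⟧ _)) ⟩
    sum (λ a → ⟦ A a ⟧ * N a) * (k * k ^ count e′)
      ≡⟨ *-distribʳ-sum (k * k ^ count e′) (λ a → ⟦ A a ⟧ * N a) ⟩
    sum (λ a → ⟦ A a ⟧ * N a * (k * k ^ count e′))
      ≡⟨ sum-cong-≗ term ⟩
    sum (λ a → k * (⟦ A a ⟧ * C))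
      ≡⟨ *-distribˡ-sum k (λ a → ⟦ A a ⟧ * C) ⟨
    k * sum (λ a → ⟦ A a ⟧ * C)
      ≡⟨ cong (k *_) (*-distribʳ-sum C (⟦_⟧ ∘ A)) ⟨
    k * (count A * (k ^ n * falling (count A ∸ 1) (count e′)))
      ≡⟨ rearrange k (count A) (k ^ n) _ ⟩
    k * k ^ n * (count A * falling (count A ∸ 1) (count e′))
      ∎
  where
  open ≡-Reasoning
  e′ = e ∘ suc
  N : Fin k → ℕ
  N a = ∑ᶜ n (λ c → ⟦ injectiveInto e′ (remove A a) c ⟧)
  C = k ^ n * falling (count A ∸ 1) (count e′)
  rearrange : ∀ x y z w → x * (y * (z * w)) ≡ x * z * (y * w)
  rearrange = solve-∀
  term : ∀ a → ⟦ A a ⟧ * N a * (k * k ^ count e′) ≡ k * (⟦ A a ⟧ * C)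
  term a with A a in Aa
  ... | false = sym (*-zeroʳ k)
  ... | true  = begin
    1 * N a * (k * k ^ count e′)   ≡⟨ regroup (N a) k (k ^ count e′) ⟩
    k * (N a * k ^ count e′)       ≡⟨ cong (k *_) (∑ᶜ-injectiveInto n e′ (remove A a)) ⟩
    k * (k ^ n * falling (count (remove A a)) (count e′))
      ≡⟨ cong (λ x → k * (k ^ n * falling (x ∸ 1) (count e′))) (count-remove A a Aa) ⟩
    k * C                          ≡⟨ cong (k *_) (*-identityˡ C) ⟨
    k * (1 * C)                    ∎
    where
    regroup : ∀ x y z → 1 * x * (y * z) ≡ y * (x * z)
    regroup = solve-∀

injectiveInto⇒fibre≤ : ∀ {k n} (e : Fin n → Bool) A (c : Fin n → Fin k) → injectiveInto e A c ≡ true →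
                       ∀ a → count (λ w → e w ∧ c w == a) ≤ ⟦ A a ⟧
injectiveInto⇒fibre≤ {n = zero}  e A c inj a = z≤n
injectiveInto⇒fibre≤ {n = suc n} e A c inj a with e zero
... | false = injectiveInto⇒fibre≤ (e ∘ suc) A (c ∘ suc) inj a
... | true with ∧-true⇒ {A (c zero)} inj
... | Ac₀ , inj′ with injectiveInto⇒fibre≤ (e ∘ suc) (remove A (c zero)) (c ∘ suc) inj′ a | c zero == a in c₀==a
... | rest≤ | false = ≤-trans rest≤ (⟦∧⟧≤ (A a) _)
  where
  ⟦∧⟧≤ : ∀ x y → ⟦ x ∧ y ⟧ ≤ ⟦ x ⟧
  ⟦∧⟧≤ true  y = ⟦⟧≤1 y
  ⟦∧⟧≤ false y = z≤n
... | rest≤ | true with ==⇒≡ {a = c zero} {b = a} c₀==a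
... | refl rewrite ==-refl (c zero) | Ac₀ = s≤s rest≤

rainbow : ∀ {k n} → (Fin n → Fin k) → (Fin n → Bool) → Bool
rainbow c e = injectiveInto e (const true) c

rainbow⇒fibre≡1 : ∀ {k n} (c : Fin n → Fin k) (e : Fin n → Bool) → count e ≡ k → rainbow c e ≡ true →
                  ∀ a → count (λ w → e w ∧ c w == a) ≡ 1
rainbow⇒fibre≡1 {k} c e |e|≡k rb =
  sum≡size⇒all≡1 fibre (injectiveInto⇒fibre≤ e (const true) c rb) fibres-cover
  where
  open ≡-Reasoning
  fibre : Fin k → ℕ
  fibre a = count (λ w → e w ∧ c w == a)
  fibres-cover : sum fibre ≡ k
  fibres-cover = begin
    sum fibre
      ≡⟨ ∑-comm (λ a w → ⟦ e w ∧ c w == a ⟧) ⟩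
    sum (λ w → sum (λ a → ⟦ e w ∧ c w == a ⟧))
      ≡⟨ sum-cong-≗ (λ w → sum-cong-≗ (λ a → ⟦∧⟧ (e w) (c w == a))) ⟩
    sum (λ w → sum (λ a → ⟦ e w ⟧ * ⟦ c w == a ⟧))
      ≡⟨ sum-cong-≗ (λ w → *-distribˡ-sum ⟦ e w ⟧ (⟦_⟧ ∘ (c w ==_))) ⟨
    sum (λ w → ⟦ e w ⟧ * count (c w ==_))
      ≡⟨ sum-cong-≗ (λ w → trans (cong (⟦ e w ⟧ *_) (count-==ʳ (c w))) (*-identityʳ ⟦ e w ⟧)) ⟩
    count e
      ≡⟨ |e|≡k ⟩
    k ∎

∃-colouring-with-many-rainbow-edges : ∀ {k m n} (E : Fin m → Fin n → Bool) → (∀ i → count (E i) ≡ suc k) →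
  ∃ λ c → m * suc k ! ≤ count (λ i → rainbow c (E i)) * suc k ^ suc k
∃-colouring-with-many-rainbow-edges {k} {m} {n} E |E|≡K =
  c , *-cancelˡ-≤ (K ^ n) {{>-nonZero (m^n>0 K n)}} (begin
    K ^ n * (m * K !)        ≡⟨ total ⟨
    ∑ᶜ n rainbowEdges * K ^ K ≤⟨ *-monoˡ-≤ (K ^ K) best ⟩
    K ^ n * rainbowEdges c * K ^ K ≡⟨ *-assoc (K ^ n) _ _ ⟩
    K ^ n * (rainbowEdges c * K ^ K) ∎)
  where
  open ≤-Reasoning
  K = suc k
  rainbowEdges : (Fin n → Fin K) → ℕ
  rainbowEdges c = count (λ i → rainbow c (E i))
  c = proj₁ (∃-≥-averageᶜ n rainbowEdges)
  best = proj₂ (∃-≥-averageᶜ n rainbowEdges)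
  per-edge : ∀ i → ∑ᶜ n (λ c → ⟦ rainbow c (E i) ⟧) * K ^ K ≡ K ^ n * K !
  per-edge i = begin-equality
    ∑ᶜ n (λ c → ⟦ rainbow c (E i) ⟧) * K ^ K
      ≡⟨ cong (λ x → ∑ᶜ n (λ c → ⟦ rainbow c (E i) ⟧) * K ^ x) (|E|≡K i) ⟨
    ∑ᶜ n (λ c → ⟦ rainbow c (E i) ⟧) * K ^ count (E i)
      ≡⟨ ∑ᶜ-injectiveInto n (E i) (const true) ⟩
    K ^ n * falling (count (const {B = Fin K} true)) (count (E i))
      ≡⟨ cong₂ (λ x y → K ^ n * falling x y) (count-all K) (|E|≡K i) ⟩
    K ^ n * falling K K
      ≡⟨ cong (K ^ n *_) (falling-self K) ⟩
    K ^ n * K ! ∎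
  total : ∑ᶜ n rainbowEdges * K ^ K ≡ K ^ n * (m * K !)
  total = begin-equality
    ∑ᶜ n rainbowEdges * K ^ K
      ≡⟨ cong (_* K ^ K) (∑ᶜ-comm n (λ c i → ⟦ rainbow c (E i) ⟧)) ⟩
    sum (λ i → ∑ᶜ n (λ c → ⟦ rainbow c (E i) ⟧)) * K ^ K
      ≡⟨ *-distribʳ-sum (K ^ K) (λ i → ∑ᶜ n (λ c → ⟦ rainbow c (E i) ⟧)) ⟩
    sum (λ i → ∑ᶜ n (λ c → ⟦ rainbow c (E i) ⟧) * K ^ K)
      ≡⟨ sum-cong-≗ per-edge ⟩
    ∑[ _ < m ] (K ^ n * K !)
      ≡⟨ sum-const m _ ⟩
    m * (K ^ n * K !)
      ≡⟨ x∙yz≈y∙xz m (K ^ n) (K !) ⟩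
    K ^ n * (m * K !) ∎

∣∣≡count : ∀ {n} (v : Subset n) → ∣ v ∣ ≡ count (lookup v)
∣∣≡count []          = refl
∣∣≡count (true  Vec.∷ v) = cong suc (∣∣≡count v)
∣∣≡count (false Vec.∷ v) = ∣∣≡count v

∣tabulate∣ : ∀ {n} (p : Fin n → Bool) → ∣ tabulate p ∣ ≡ count p
∣tabulate∣ p = trans (∣∣≡count (tabulate p)) (sum-cong-≗ (cong ⟦_⟧ ∘ lookup∘tabulate p))

∣∩∣≡count : ∀ {n} (u v : Subset n) → ∣ u ∩ v ∣ ≡ count (λ i → lookup u i ∧ lookup v i)
∣∩∣≡count u v = trans (∣∣≡count (u ∩ v)) (sum-cong-≗ λ i → cong ⟦_⟧ (lookup-zipWith _∧_ i u v))

∣∩tabulate∣ : ∀ {n} (u : Subset n) (p : Fin n → Bool) → ∣ u ∩ tabulate p ∣ ≡ count (λ i → lookup u i ∧ p i)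
∣∩tabulate∣ u p = trans (∣∩∣≡count u (tabulate p))
  (sum-cong-≗ λ i → cong (λ b → ⟦ lookup u i ∧ b ⟧) (lookup∘tabulate p i))

∈-tabulate⁻ : ∀ {n} {p : Fin n → Bool} {i} → i ∈ tabulate p → p i ≡ true
∈-tabulate⁻ {p = p} {i} i∈p = trans (sym (lookup∘tabulate p i)) ([]=⇒lookup i∈p)

does-∈? : ∀ {n} (w : Fin n) (v : Subset n) → does (w ∈? v) ≡ lookup v w
does-∈? zero    (true  Vec.∷ v) = refl
does-∈? zero    (false Vec.∷ v) = refl
does-∈? (suc w) (x     Vec.∷ v) = does-∈? w v

degree-tabulate : ∀ {n m} (edge : Fin m → Subset n) (T : Fin m → Bool) w →
                  degree edge (tabulate T) w ≡ count (λ i → T i ∧ lookup (edge i) w)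
degree-tabulate edge T w = trans (∣∩tabulate∣ (tabulate T) (λ i → does (w ∈? edge i)))
  (sum-cong-≗ λ i → cong₂ (λ a b → ⟦ a ∧ b ⟧) (lookup∘tabulate T i) (does-∈? w (edge i)))

Uniform⇒count : ∀ {k n m} (edge : Fin m → Subset n) → Uniform k edge → ∀ i → count (lookup (edge i)) ≡ k
Uniform⇒count edge uniform i = trans (sym (∣∣≡count (edge i))) (uniform i)

-- Degrees in linear hypergraphs

Uniform⇒other-vertex : ∀ {k m n} (edge : Fin m → Subset n) → 2 ≤ k → Uniform k edge →
                       ∀ i w → 1 ≤ count (λ v → lookup (edge i) v ∧ not (v == w))
Uniform⇒other-vertex {k} edge 2≤k uniform i w = +-cancelˡ-≤ 1 1 _ (begin
  2                                                    ≤⟨ 2≤k ⟩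
  k                                                    ≡⟨ Uniform⇒count edge uniform i ⟨
  count e                                              ≡⟨ count-split e (_== w) ⟩
  count (λ v → e v ∧ v == w) + count (λ v → e v ∧ not (v == w))
    ≤⟨ +-monoˡ-≤ _ (≤-trans (count-mono at-w) (≤-reflexive (count-==ˡ w))) ⟩
  1 + count (λ v → e v ∧ not (v == w))                 ∎)
  where
  open ≤-Reasoning
  e = lookup (edge i)
  at-w : (λ v → e v ∧ v == w) ⊆ (_== w)
  at-w v = proj₂ ∘ ∧-true⇒ {e v}

Linear⇒codegree≤1 : ∀ {m n} (edge : Fin m → Subset n) → Linear edge → ∀ {w v} → w ≢ v →
                    count (λ i → lookup (edge i) w ∧ lookup (edge i) v) ≤ 1
Linear⇒codegree≤1 edge linear {w} {v} w≢v = count≤1 _ unique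
  where
  unique : ∀ i j → lookup (edge i) w ∧ lookup (edge i) v ≡ true →
                   lookup (edge j) w ∧ lookup (edge j) v ≡ true → i ≡ j
  unique i j wv∈i wv∈j with i Fin.≟ j
  ... | yes i≡j = i≡j
  ... | no  i≢j = ⊥-elim (<-irrefl refl (≤-trans
          (count≥2 (λ u → lookup (edge i) u ∧ lookup (edge j) u) w v
            (cong₂ _∧_ (proj₁ (∧-true⇒ wv∈i)) (proj₁ (∧-true⇒ {lookup (edge j) w} wv∈j)))
            (cong₂ _∧_ (proj₂ (∧-true⇒ wv∈i)) (proj₂ (∧-true⇒ {lookup (edge j) w} wv∈j)))
            w≢v)
          (subst (_≤ 1) (∣∩∣≡count (edge i) (edge j)) (linear i j i≢j))))

-- Each edge through w contains another vertex v, and linearity lets v lie in only one such edge.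
linear⇒degree< : ∀ {m n k} (edge : Fin m → Subset n) → 2 ≤ k → Uniform k edge → Linear edge →
                 ∀ w → count (λ i → lookup (edge i) w) < n
linear⇒degree< {m} {n} edge 2≤k uniform linear w = begin-strict
  count (λ i → E i w)
    ≤⟨ sum-mono-≤ edge-has-other ⟩
  sum (λ i → ⟦ E i w ⟧ * others i)
    ≡⟨ sum-cong-≗ (λ i → *-distribˡ-sum ⟦ E i w ⟧ (λ v → ⟦ E i v ∧ not (v == w) ⟧)) ⟩
  sum (λ i → sum (λ v → ⟦ E i w ⟧ * ⟦ E i v ∧ not (v == w) ⟧))
    ≡⟨ ∑-comm (λ i v → ⟦ E i w ⟧ * ⟦ E i v ∧ not (v == w) ⟧) ⟩
  sum (λ v → sum (λ i → ⟦ E i w ⟧ * ⟦ E i v ∧ not (v == w) ⟧))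
    ≡⟨ sum-cong-≗ (λ v → trans (*-distribˡ-sum ⟦ not (v == w) ⟧ (λ i → ⟦ E i w ∧ E i v ⟧))
                               (sum-cong-≗ (λ i → regroup (E i w) (E i v) (v == w)))) ⟨
  sum (λ v → ⟦ not (v == w) ⟧ * count (λ i → E i w ∧ E i v))
    ≤⟨ sum-mono-≤ codegree≤1 ⟩
  count (λ v → not (v == w))
    <⟨ n<1+n _ ⟩
  1 + count (λ v → not (v == w))
    ≡⟨ cong (_+ count (λ v → not (v == w))) (count-==ˡ w) ⟨
  count (_== w) + count (λ v → not (v == w))
    ≡⟨ count-split (const true) (_== w) ⟨
  count (const {B = Fin n} true)
    ≡⟨ count-all n ⟩
  n ∎
  where
  open ≤-Reasoning
  E : Fin m → Fin n → Bool
  E i = lookup (edge i)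
  others : Fin m → ℕ
  others i = count (λ v → E i v ∧ not (v == w))
  edge-has-other : ∀ i → ⟦ E i w ⟧ ≤ ⟦ E i w ⟧ * others i
  edge-has-other i with E i w
  ... | false = z≤n
  ... | true  = ≤-trans (Uniform⇒other-vertex edge 2≤k uniform i w) (≤-reflexive (sym (+-identityʳ _)))
  regroup : ∀ a b c → ⟦ not c ⟧ * ⟦ a ∧ b ⟧ ≡ ⟦ a ⟧ * ⟦ b ∧ not c ⟧
  regroup true  true  true  = refl
  regroup true  true  false = refl
  regroup true  false c     = *-zeroʳ ⟦ not c ⟧
  regroup false b     c     = *-zeroʳ ⟦ not c ⟧
  codegree≤1 : ∀ v → ⟦ not (v == w) ⟧ * count (λ i → E i w ∧ E i v) ≤ ⟦ not (v == w) ⟧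
  codegree≤1 v with v Fin.≟ w
  ... | yes _   = z≤n
  ... | no  v≢w = ≤-trans (≤-reflexive (+-identityʳ _)) (Linear⇒codegree≤1 edge linear (v≢w ∘ sym))

-- Partial sums of the exponential series

sumUpTo-cong : ∀ {f g : ℕ → ℕ} M → (∀ j → j ≤ M → f j ≡ g j) → sumUpTo f M ≡ sumUpTo g M
sumUpTo-cong zero    f≡g = f≡g 0 z≤n
sumUpTo-cong (suc M) f≡g = cong₂ _+_ (sumUpTo-cong M (λ j j≤M → f≡g j (m≤n⇒m≤1+n j≤M))) (f≡g (suc M) ≤-refl)

sumUpTo-*ˡ : ∀ (f : ℕ → ℕ) c M → sumUpTo (λ j → c * f j) M ≡ c * sumUpTo f M
sumUpTo-*ˡ f c zero    = refl
sumUpTo-*ˡ f c (suc M) = trans (cong (_+ c * f (suc M)) (sumUpTo-*ˡ f c M)) (sym (*-distribˡ-+ c _ _))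

expPartialScaled-suc : ∀ x M → expPartialScaled x (suc M) ≡ suc M * expPartialScaled x M + x ^ suc M
expPartialScaled-suc x M = cong₂ _+_
  (trans (sumUpTo-cong M lower-terms) (sumUpTo-*ˡ (λ j → x ^ j * (M ! / j !) {{j !≢0}}) (suc M) M))
  (trans (cong (x ^ suc M *_) (n/n≡1 (suc M !) {{suc M !≢0}})) (*-identityʳ _))
  where
  lower-terms : ∀ j → j ≤ M →
    x ^ j * (suc M ! / j !) {{j !≢0}} ≡ suc M * (x ^ j * (M ! / j !) {{j !≢0}})
  lower-terms j j≤M = trans (cong (x ^ j *_) (*-/-assoc (suc M) {{j !≢0}} (m≤n⇒m!∣n! j≤M)))
                            (x∙yz≈y∙xz (x ^ j) (suc M) _)

ExpAtLeast-raise : ∀ n {x} M d → n * M ! ≤ expPartialScaled x M → n * (d + M) ! ≤ expPartialScaled x (d + M)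
ExpAtLeast-raise n M zero    bound = bound
ExpAtLeast-raise n {x} M (suc d) bound = begin
  n * (suc (d + M) * (d + M) !)             ≡⟨ x∙yz≈y∙xz n (suc (d + M)) _ ⟩
  suc (d + M) * (n * (d + M) !)             ≤⟨ *-monoʳ-≤ (suc (d + M)) (ExpAtLeast-raise n M d bound) ⟩
  suc (d + M) * expPartialScaled x (d + M)  ≤⟨ m≤m+n _ _ ⟩
  suc (d + M) * expPartialScaled x (d + M) + x ^ suc (d + M) ≡⟨ expPartialScaled-suc x (d + M) ⟨
  expPartialScaled x (suc d + M)            ∎
  where open ≤-Reasoning

expPartialScaled-overshoot : ∀ x C M → x ≤ M → expPartialScaled x M + x ^ suc M ≤ C * M ! →
  expPartialScaled x (suc M) + x ^ suc (suc M) ≤ C * suc M !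
expPartialScaled-overshoot x C M x≤M bound = begin
  expPartialScaled x (suc M) + x * x ^ suc M
    ≡⟨ cong (_+ x * x ^ suc M) (expPartialScaled-suc x M) ⟩
  suc M * expPartialScaled x M + x ^ suc M + x * x ^ suc M
    ≡⟨ +-assoc (suc M * expPartialScaled x M) _ _ ⟩
  suc M * expPartialScaled x M + suc x * x ^ suc M
    ≤⟨ +-monoʳ-≤ (suc M * expPartialScaled x M) (*-monoˡ-≤ (x ^ suc M) (s≤s x≤M)) ⟩
  suc M * expPartialScaled x M + suc M * x ^ suc M
    ≡⟨ *-distribˡ-+ (suc M) (expPartialScaled x M) (x ^ suc M) ⟨
  suc M * (expPartialScaled x M + x ^ suc M)
    ≤⟨ *-monoʳ-≤ (suc M) bound ⟩
  suc M * (C * M !)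
    ≡⟨ x∙yz≈y∙xz (suc M) C (M !) ⟩
  C * suc M ! ∎
  where open ≤-Reasoning

expPartialScaled-overshoot-from : ∀ x C d → expPartialScaled x x + x ^ suc x ≤ C * x ! →
  expPartialScaled x (d + x) + x ^ suc (d + x) ≤ C * (d + x) !
expPartialScaled-overshoot-from x C zero    bound = bound
expPartialScaled-overshoot-from x C (suc d) bound =
  expPartialScaled-overshoot x C (d + x) (m≤n+m x d) (expPartialScaled-overshoot-from x C d bound)

ExpAtLeast⇒< : ∀ {n x} .{{_ : NonZero x}} C → expPartialScaled x x + x ^ suc x ≤ C * x ! → ExpAtLeast n x → n < C
ExpAtLeast⇒< {n} {x} C bound (M , n≤e) = *-cancelʳ-< ((x + M) !) n C (begin-strict
  n * (x + M) !                                  ≤⟨ ExpAtLeast-raise n M x n≤e ⟩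
  expPartialScaled x (x + M)                     <⟨ m<m+n _ (m^n>0 x (suc (x + M))) ⟩
  expPartialScaled x (x + M) + x ^ suc (x + M)   ≡⟨ cong (λ N → expPartialScaled x N + x ^ suc N) (+-comm x M) ⟩
  expPartialScaled x (M + x) + x ^ suc (M + x)   ≤⟨ expPartialScaled-overshoot-from x C M bound ⟩
  C * (M + x) !                                  ≡⟨ cong (λ N → C * N !) (+-comm M x) ⟩
  C * (x + M) !                                  ∎)
  where open ≤-Reasoning

^-distribʳ-* : ∀ m n o → (m * n) ^ o ≡ m ^ o * n ^ o
^-distribʳ-* m n zero    = refl
^-distribʳ-* m n (suc o) = trans (cong (m * n *_) (^-distribʳ-* m n o)) (interchange m n _ _)

expPartialScaled≤ : ∀ x M → M ≤ x → expPartialScaled x M ≤ suc M * x ^ M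
expPartialScaled≤ x zero    _   = ≤-refl
expPartialScaled≤ x (suc M) M<x = begin
  expPartialScaled x (suc M)                  ≡⟨ expPartialScaled-suc x M ⟩
  suc M * expPartialScaled x M + x ^ suc M
    ≤⟨ +-monoˡ-≤ (x ^ suc M) (*-monoʳ-≤ (suc M) (expPartialScaled≤ x M (<⇒≤ M<x))) ⟩
  suc M * (suc M * x ^ M) + x ^ suc M
    ≤⟨ +-monoˡ-≤ (x ^ suc M) (*-monoʳ-≤ (suc M) (*-monoˡ-≤ (x ^ M) M<x)) ⟩
  suc M * x ^ suc M + x ^ suc M               ≡⟨ +-comm (suc M * x ^ suc M) _ ⟩
  suc (suc M) * x ^ suc M                     ∎
  where open ≤-Reasoning

2x+1≤2^x*x! : ∀ y → 2 * (2 + y) + 1 ≤ 2 ^ (2 + y) * (2 + y) !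
2x+1≤2^x*x! zero    = s≤s (s≤s (s≤s (s≤s (s≤s z≤n))))
2x+1≤2^x*x! (suc y) = begin
  2 * (3 + y) + 1        ≡⟨ shift y ⟩
  2 + (2 * (2 + y) + 1)  ≤⟨ +-mono-≤ (≤-trans (s≤s (s≤s z≤n)) IH) IH ⟩
  P + P                  ≡⟨ cong (P +_) (*-identityˡ P) ⟨
  2 * P                  ≤⟨ *-monoˡ-≤ P (m≤m*n 2 (3 + y)) ⟩
  2 * (3 + y) * P        ≡⟨ rearrange (2 ^ (2 + y)) ((2 + y) !) y ⟩
  2 ^ (3 + y) * (3 + y) ! ∎
  where
  open ≤-Reasoning
  P = 2 ^ (2 + y) * (2 + y) !
  IH = 2x+1≤2^x*x! y
  shift : ∀ y → 2 * (3 + y) + 1 ≡ 2 + (2 * (2 + y) + 1)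
  shift = solve-∀
  rearrange : ∀ a b y → 2 * (3 + y) * (a * b) ≡ 2 * a * ((3 + y) * b)
  rearrange = solve-∀

ExpAtLeast-zero : ∀ {n} → ExpAtLeast n 0 → n ≤ 1
ExpAtLeast-zero {n} (M , n≤e) = *-cancelʳ-≤ n 1 (M !) {{M !≢0}} (begin
  n * M !               ≤⟨ n≤e ⟩
  expPartialScaled 0 M  ≡⟨ expPartialScaled-zero M ⟩
  M !                   ≡⟨ +-identityʳ (M !) ⟨
  1 * M !               ∎)
  where
  open ≤-Reasoning
  expPartialScaled-zero : ∀ M → expPartialScaled 0 M ≡ M !
  expPartialScaled-zero zero    = refl
  expPartialScaled-zero (suc M) = trans (expPartialScaled-suc 0 M) (trans (+-identityʳ _) (cong (suc M *_) (expPartialScaled-zero M)))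

ExpAtLeast⇒≤[2x]^x : ∀ {n} x .{{_ : NonZero x}} → ExpAtLeast n x → n ≤ (2 * x) ^ x
ExpAtLeast⇒≤[2x]^x 1 e = s≤s⁻¹ (ExpAtLeast⇒< 3 ≤-refl e)
ExpAtLeast⇒≤[2x]^x {n} x@(suc (suc y)) e = <⇒≤ (ExpAtLeast⇒< ((2 * x) ^ x) (begin
  expPartialScaled x x + x * x ^ x  ≤⟨ +-monoˡ-≤ (x * x ^ x) (expPartialScaled≤ x x ≤-refl) ⟩
  suc x * x ^ x + x * x ^ x         ≡⟨ *-distribʳ-+ (x ^ x) (suc x) x ⟨
  (suc x + x) * x ^ x               ≡⟨ cong (_* x ^ x) (double x) ⟩
  (2 * x + 1) * x ^ x               ≤⟨ *-monoˡ-≤ (x ^ x) (2x+1≤2^x*x! y) ⟩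
  2 ^ x * x ! * x ^ x               ≡⟨ xy∙z≈xz∙y (2 ^ x) (x !) (x ^ x) ⟩
  2 ^ x * x ^ x * x !               ≡⟨ cong (_* x !) (^-distribʳ-* 2 x x) ⟨
  (2 * x) ^ x * x !                 ∎) e)
  where
  open ≤-Reasoning
  double : ∀ x → suc x + x ≡ 2 * x + 1
  double = solve-∀

-- Degree buckets

≤ᵇ≡true⇒≤ : ∀ {m n} → (m ≤ᵇ n) ≡ true → m ≤ n
≤ᵇ≡true⇒≤ {m} {n} = ≤ᵇ⇒≤ m n ∘ Equivalence.from T-≡

≤⇒≤ᵇ≡true : ∀ {m n} → m ≤ n → (m ≤ᵇ n) ≡ true
≤⇒≤ᵇ≡true = Equivalence.to T-≡ ∘ ≤⇒≤ᵇ

<ᵇ≡true⇒< : ∀ {m n} → (m <ᵇ n) ≡ true → m < n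
<ᵇ≡true⇒< {m} {n} = <ᵇ⇒< m n ∘ Equivalence.from T-≡

<⇒<ᵇ≡true : ∀ {m n} → m < n → (m <ᵇ n) ≡ true
<⇒<ᵇ≡true = Equivalence.to T-≡ ∘ <⇒<ᵇ

∃-power-bracket : ∀ r L d → 1 ≤ d → d < r ^ L → ∃ λ (β : Fin L) → r ^ toℕ β ≤ d × d < r ^ suc (toℕ β)
∃-power-bracket r zero    d 1≤d d<1 = ⊥-elim (<-irrefl refl (≤-trans d<1 1≤d))
∃-power-bracket r (suc L) d 1≤d d<r^L+1 with d <? r ^ L
... | yes d<r^L = let β , lower , upper = ∃-power-bracket r L d 1≤d d<r^L in
  inject₁ β , subst (λ b → r ^ b ≤ d) (sym (Fin.toℕ-inject₁ β)) lower
            , subst (λ b → d < r ^ suc b) (sym (Fin.toℕ-inject₁ β)) upper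
... | no  d≮r^L =
  fromℕ L , subst (λ b → r ^ b ≤ d) (sym (Fin.toℕ-fromℕ L)) (≮⇒≥ d≮r^L)
          , subst (λ b → d < r ^ suc b) (sym (Fin.toℕ-fromℕ L)) d<r^L+1

module DegreeBuckets {m n : ℕ} (E : Fin m → Fin n → Bool) (r L′ : ℕ)
                  (degree< : ∀ w → count (λ i → E i w) < r ^ suc L′) where

  L : ℕ
  L = suc L′

  deg : (Fin m → Bool) → Fin n → ℕ
  deg T w = count (λ i → T i ∧ E i w)

  meets : (Fin n → Bool) → Fin m → ℕ
  meets Y i = count (λ w → E i w ∧ Y w)

  through : (Fin m → Bool) → (Fin n → Bool) → Fin m → Bool
  through T Y i = T i ∧ (0 <ᵇ meets Y i)

  deg-mono : ∀ {T T′} → T ⊆ T′ → ∀ w → deg T w ≤ deg T′ w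
  deg-mono {T} T⊆T′ w = count-mono λ i Ti∧Eiw →
    cong₂ _∧_ (T⊆T′ i (proj₁ (∧-true⇒ {T i} Ti∧Eiw))) (proj₂ (∧-true⇒ {T i} Ti∧Eiw))

  meets-mono : ∀ {Y Y′} → Y ⊆ Y′ → ∀ i → meets Y i ≤ meets Y′ i
  meets-mono Y⊆Y′ i = count-mono λ w Eiw∧Yw →
    cong₂ _∧_ (proj₁ (∧-true⇒ {E i w} Eiw∧Yw)) (Y⊆Y′ w (proj₂ (∧-true⇒ {E i w} Eiw∧Yw)))

  through⊆ : ∀ T Y → through T Y ⊆ T
  through⊆ T Y i = proj₁ ∘ ∧-true⇒ {T i}

  deg<r^L : ∀ T w → deg T w < r ^ L
  deg<r^L T w = ≤-<-trans (count-mono (λ i → proj₂ ∘ ∧-true⇒ {T i})) (degree< w)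

  ∑-deg≡∑-meets : ∀ T Y → sum (λ v → ⟦ Y v ⟧ * deg T v) ≡ sum (λ i → ⟦ T i ⟧ * meets Y i)
  ∑-deg≡∑-meets T Y = begin
    sum (λ v → ⟦ Y v ⟧ * deg T v)
      ≡⟨ sum-cong-≗ (λ v → *-distribˡ-sum ⟦ Y v ⟧ (λ i → ⟦ T i ∧ E i v ⟧)) ⟩
    sum (λ v → sum (λ i → ⟦ Y v ⟧ * ⟦ T i ∧ E i v ⟧))
      ≡⟨ ∑-comm (λ v i → ⟦ Y v ⟧ * ⟦ T i ∧ E i v ⟧) ⟩
    sum (λ i → sum (λ v → ⟦ Y v ⟧ * ⟦ T i ∧ E i v ⟧))
      ≡⟨ sum-cong-≗ (λ i → sum-cong-≗ (λ v → regroup (Y v) (T i) (E i v))) ⟩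
    sum (λ i → sum (λ v → ⟦ T i ⟧ * ⟦ E i v ∧ Y v ⟧))
      ≡⟨ sum-cong-≗ (λ i → *-distribˡ-sum ⟦ T i ⟧ (λ v → ⟦ E i v ∧ Y v ⟧)) ⟨
    sum (λ i → ⟦ T i ⟧ * meets Y i) ∎
    where
    open ≡-Reasoning
    regroup : ∀ y t e → ⟦ y ⟧ * ⟦ t ∧ e ⟧ ≡ ⟦ t ⟧ * ⟦ e ∧ y ⟧
    regroup y     false e     = *-zeroʳ ⟦ y ⟧
    regroup y     true  false = *-zeroʳ ⟦ y ⟧
    regroup false true  true  = refl
    regroup true  true  true  = refl

  ∑-meets≤through : ∀ T Y → (∀ i → T i ≡ true → meets Y i ≤ 1) →
                    sum (λ i → ⟦ T i ⟧ * meets Y i) ≤ count (through T Y)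
  ∑-meets≤through T Y once = sum-mono-≤ pointwise
    where
    bound : ∀ x → x ≤ 1 → 1 * x ≤ ⟦ 0 <ᵇ x ⟧
    bound zero          _ = z≤n
    bound (suc zero)    _ = ≤-refl
    bound (suc (suc x)) (s≤s ())
    pointwise : ∀ i → ⟦ T i ⟧ * meets Y i ≤ ⟦ through T Y i ⟧
    pointwise i with T i in Ti
    ... | false = z≤n
    ... | true  = bound (meets Y i) (once i Ti)

  bucket : (Fin n → Bool) → (Fin m → Bool) → Fin L → Fin n → Bool
  bucket Q T β w = Q w ∧ ((r ^ toℕ β ≤ᵇ deg T w) ∧ (deg T w <ᵇ r ^ suc (toℕ β)))

  bucket⊆ : ∀ Q T β → bucket Q T β ⊆ Q
  bucket⊆ Q T β w = proj₁ ∘ ∧-true⇒ {Q w}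

  edge-in-some-bucket : ∀ Q T → (∀ i → T i ≡ true → 1 ≤ meets Q i) →
                        ∀ i → ⟦ T i ⟧ ≤ sum (λ β → ⟦ through T (bucket Q T β) i ⟧)
  edge-in-some-bucket Q T meetsQ i = ⟦⟧≤-intro (T i) λ Ti →
    let w , Eiw∧Qw = count≥1⇒holds (λ w → E i w ∧ Q w) (meetsQ i Ti)
        Eiw , Qw = ∧-true⇒ {E i w} Eiw∧Qw
        β , lower , upper = ∃-power-bracket r L (deg T w) (holds⇒count≥1 _ i (cong₂ _∧_ Ti Eiw)) (deg<r^L T w)
        w∈β : bucket Q T β w ≡ true
        w∈β = cong₂ _∧_ Qw (cong₂ _∧_ (≤⇒≤ᵇ≡true lower) (<⇒<ᵇ≡true upper))
        i∈β : through T (bucket Q T β) i ≡ true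
        i∈β = cong₂ _∧_ Ti (<⇒<ᵇ≡true (holds⇒count≥1 _ w (cong₂ _∧_ Eiw w∈β)))
    in holds⇒count≥1 (λ β → through T (bucket Q T β) i) β i∈β

  largest-bucket : ∀ Q T → (∀ i → T i ≡ true → 1 ≤ meets Q i) →
                   ∃ λ β → count T ≤ L * count (through T (bucket Q T β))
  largest-bucket Q T meetsQ = β , (begin
    count T                                                 ≤⟨ sum-mono-≤ (edge-in-some-bucket Q T meetsQ) ⟩
    sum (λ i → sum (λ β → ⟦ through T (bucket Q T β) i ⟧))  ≡⟨ ∑-comm (λ i β → ⟦ through T (bucket Q T β) i ⟧) ⟩
    sum edgesMeeting                                        ≤⟨ proj₂ (∃-≥-average L′ edgesMeeting) ⟩
    L * edgesMeeting β                                      ∎)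
    where
    open ≤-Reasoning
    edgesMeeting : Fin L → ℕ
    edgesMeeting β = count (through T (bucket Q T β))
    β = proj₁ (∃-≥-average L′ edgesMeeting)

  bucket-balanced : ∀ Q T β → (∀ i → T i ≡ true → meets Q i ≤ 1) →
    ∀ w → bucket Q T β w ≡ true →
    deg (through T (bucket Q T β)) w * count (bucket Q T β) ≤ r * count (through T (bucket Q T β))
  bucket-balanced Q T β onceQ w w∈Y = begin
    deg T′ w * count Y                  ≤⟨ *-monoˡ-≤ (count Y) (≤-trans (deg-mono (through⊆ T Y) w) (<⇒≤ upper)) ⟩
    r * r ^ b * count Y                 ≡⟨ *-assoc r (r ^ b) (count Y) ⟩
    r * (r ^ b * count Y)               ≤⟨ *-monoʳ-≤ r lower-bound ⟩
    r * count T′                        ∎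
    where
    open ≤-Reasoning
    b = toℕ β
    Y = bucket Q T β
    T′ = through T Y
    upper : deg T w < r ^ suc b
    upper = <ᵇ≡true⇒< (proj₂ (∧-true⇒ (proj₂ (∧-true⇒ {Q w} w∈Y))))
    deg≥ : ∀ v → r ^ b * ⟦ Y v ⟧ ≤ ⟦ Y v ⟧ * deg T v
    deg≥ v with Y v in v∈Y
    ... | false = ≤-reflexive (*-zeroʳ (r ^ b))
    ... | true  = begin
      r ^ b * 1    ≡⟨ *-identityʳ (r ^ b) ⟩
      r ^ b        ≤⟨ ≤ᵇ≡true⇒≤ (proj₁ (∧-true⇒ (proj₂ (∧-true⇒ {Q v} v∈Y)))) ⟩
      deg T v      ≡⟨ *-identityˡ (deg T v) ⟨
      1 * deg T v  ∎
    onceY : ∀ i → T i ≡ true → meets Y i ≤ 1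
    onceY i Ti = ≤-trans (meets-mono (bucket⊆ Q T β) i) (onceQ i Ti)
    lower-bound : r ^ b * count Y ≤ count T′
    lower-bound = begin
      r ^ b * count Y                      ≡⟨ *-distribˡ-sum (r ^ b) (⟦_⟧ ∘ Y) ⟩
      sum (λ v → r ^ b * ⟦ Y v ⟧)          ≤⟨ sum-mono-≤ deg≥ ⟩
      sum (λ v → ⟦ Y v ⟧ * deg T v)        ≡⟨ ∑-deg≡∑-meets T Y ⟩
      sum (λ i → ⟦ T i ⟧ * meets Y i)      ≤⟨ ∑-meets≤through T Y onceY ⟩
      count T′                             ∎

  -- balanced encodes the balance r * L ^ (j ∸ 1), multiplied through by L so that j = 0 fits.
  record Refinement (j : ℕ) (Q : Fin j → Fin n → Bool) (T₀ : Fin m → Bool) : Set where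
    field
      T          : Fin m → Bool
      Y          : Fin j → Fin n → Bool
      T⊆T₀       : T ⊆ T₀
      Y⊆Q        : ∀ b → Y b ⊆ Q b
      meets-once : ∀ i → T i ≡ true → ∀ b → meets (Y b) i ≡ 1
      shrink     : count T₀ ≤ L ^ j * count T
      balanced   : ∀ b w → Y b w ≡ true → L * (deg T w * count (Y b)) ≤ r * L ^ j * count T

  refine : ∀ j (Q : Fin j → Fin n → Bool) T₀ → (∀ i → T₀ i ≡ true → ∀ b → meets (Q b) i ≡ 1) →
           Refinement j Q T₀
  refine zero Q T₀ onceQ = record
    { T = T₀ ; Y = λ () ; T⊆T₀ = λ _ → id ; Y⊆Q = λ () ; meets-once = λ _ _ ()
    ; shrink = ≤-reflexive (sym (+-identityʳ _)) ; balanced = λ () }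
  refine (suc j) Q T₀ onceQ = record
    { T = T ; Y = Y₀ ∷ Y ; T⊆T₀ = λ i → through⊆ T₀ Y₀ i ∘ T⊆T₁ i ; Y⊆Q = Y⊆Q′
    ; meets-once = meets-once′ ; shrink = shrink′ ; balanced = balanced′ }
    where
    onceQ₀ : ∀ i → T₀ i ≡ true → meets (Q zero) i ≡ 1
    onceQ₀ i T₀i = onceQ i T₀i zero
    largest = largest-bucket (Q zero) T₀ (λ i → ≤-reflexive ∘ sym ∘ onceQ₀ i)
    β = proj₁ largest
    Y₀ = bucket (Q zero) T₀ β
    T₁ = through T₀ Y₀
    rest = refine j (Q ∘ suc) T₁ (λ i T₁i → onceQ i (through⊆ T₀ Y₀ i T₁i) ∘ suc)
    open Refinement rest renaming (T⊆T₀ to T⊆T₁)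
    Y⊆Q′ : ∀ b → (Y₀ ∷ Y) b ⊆ Q b
    Y⊆Q′ zero    = bucket⊆ (Q zero) T₀ β
    Y⊆Q′ (suc b) = Y⊆Q b
    meets-once′ : ∀ i → T i ≡ true → ∀ b → meets ((Y₀ ∷ Y) b) i ≡ 1
    meets-once′ i Ti zero    = ≤-antisym
      (≤-trans (meets-mono (bucket⊆ (Q zero) T₀ β) i) (≤-reflexive (onceQ₀ i (through⊆ T₀ Y₀ i (T⊆T₁ i Ti)))))
      (<ᵇ≡true⇒< (proj₂ (∧-true⇒ {T₀ i} (T⊆T₁ i Ti))))
    meets-once′ i Ti (suc b) = meets-once i Ti b
    shrink′ : count T₀ ≤ L ^ suc j * count T
    shrink′ = begin
      count T₀                ≤⟨ proj₂ largest ⟩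
      L * count T₁            ≤⟨ *-monoʳ-≤ L shrink ⟩
      L * (L ^ j * count T)   ≡⟨ *-assoc L (L ^ j) (count T) ⟨
      L ^ suc j * count T     ∎
      where open ≤-Reasoning
    balanced′ : ∀ b w → (Y₀ ∷ Y) b w ≡ true → L * (deg T w * count ((Y₀ ∷ Y) b)) ≤ r * L ^ suc j * count T
    balanced′ zero w w∈Y₀ = begin
      L * (deg T w * count Y₀)       ≤⟨ *-monoʳ-≤ L (*-monoˡ-≤ (count Y₀) (deg-mono T⊆T₁ w)) ⟩
      L * (deg T₁ w * count Y₀)
        ≤⟨ *-monoʳ-≤ L (bucket-balanced (Q zero) T₀ β (λ i → ≤-reflexive ∘ onceQ₀ i) w w∈Y₀) ⟩
      L * (r * count T₁)             ≤⟨ *-monoʳ-≤ L (*-monoʳ-≤ r shrink) ⟩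
      L * (r * (L ^ j * count T))    ≡⟨ rearrange L r (L ^ j) (count T) ⟩
      r * (L * L ^ j) * count T      ∎
      where
      open ≤-Reasoning
      rearrange : ∀ a b c d → a * (b * (c * d)) ≡ b * (a * c) * d
      rearrange = solve-∀
    balanced′ (suc b) w w∈Y = begin
      L * (deg T w * count (Y b))    ≤⟨ balanced b w w∈Y ⟩
      r * L ^ j * count T            ≤⟨ *-monoˡ-≤ (count T) (*-monoʳ-≤ r (m≤n*m (L ^ j) L)) ⟩
      r * L ^ suc j * count T        ∎
      where open ≤-Reasoning

balanced-partite-subhypergraph : ∀ {k m n} L′ (edge : Fin m → Subset n) → Uniform (suc k) edge →
  (∀ w → count (λ i → lookup (edge i) w) < (2 * suc L′) ^ suc L′) →
  ∃₂ λ (S : Subset m) (X : Fin (suc k) → Subset n) →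
    IsPartite (suc k) edge S X × Balanced (suc k) (2 * suc L′ ^ suc k) edge S X ×
    m * suc k ! ≤ ∣ S ∣ * (suc k * suc L′) ^ suc k
balanced-partite-subhypergraph {k} {m} {n} L′ edge uniform degree< =
  tabulate T , tabulate ∘ Y , (disjoint , one-vertex-per-part) , balanced-parts , size
  where
  K = suc k
  E : Fin m → Fin n → Bool
  E i = lookup (edge i)
  colouring = ∃-colouring-with-many-rainbow-edges E (Uniform⇒count edge uniform)
  c = proj₁ colouring
  colourClass : Fin K → Fin n → Bool
  colourClass a w = c w == a
  open DegreeBuckets E (2 * suc L′) L′ degree<
  refinement : Refinement K colourClass (λ i → rainbow c (E i))
  refinement = refine K colourClass (λ i → rainbow c (E i))
    (λ i → rainbow⇒fibre≡1 c (E i) (Uniform⇒count edge uniform i))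
  open Refinement refinement

  colour : ∀ {a w} → w ∈ tabulate (Y a) → c w ≡ a
  colour {a} {w} w∈Xa = ==⇒≡ (Y⊆Q a w (∈-tabulate⁻ w∈Xa))

  disjoint : ∀ a b → a ≢ b → Empty (tabulate (Y a) ∩ tabulate (Y b))
  disjoint a b a≢b (w , w∈Xa∩Xb) = a≢b (trans (sym (colour w∈Xa)) (colour w∈Xb))
    where
    w∈Xa = proj₁ (x∈p∩q⁻ (tabulate (Y a)) (tabulate (Y b)) w∈Xa∩Xb)
    w∈Xb = proj₂ (x∈p∩q⁻ (tabulate (Y a)) (tabulate (Y b)) w∈Xa∩Xb)

  one-vertex-per-part : ∀ i → i ∈ tabulate T → ∀ a → ∣ edge i ∩ tabulate (Y a) ∣ ≡ 1
  one-vertex-per-part i i∈S a = trans (∣∩tabulate∣ (edge i) (Y a)) (meets-once i (∈-tabulate⁻ i∈S) a)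

  balanced-parts : Balanced K (2 * L ^ K) edge (tabulate T) (tabulate ∘ Y)
  balanced-parts a w w∈Xa = *-cancelˡ-≤ L (begin
    L * (degree edge (tabulate T) w * ∣ tabulate (Y a) ∣)
      ≡⟨ cong₂ (λ d y → L * (d * y)) (degree-tabulate edge T w) (∣tabulate∣ (Y a)) ⟩
    L * (deg T w * count (Y a))     ≤⟨ balanced a w (∈-tabulate⁻ w∈Xa) ⟩
    2 * L * L ^ K * count T         ≡⟨ rearrange L (L ^ K) (count T) ⟩
    L * (2 * L ^ K * count T)       ≡⟨ cong (λ t → L * (2 * L ^ K * t)) (∣tabulate∣ T) ⟨
    L * (2 * L ^ K * ∣ tabulate T ∣) ∎)
    where
    open ≤-Reasoning
    rearrange : ∀ a b c → 2 * a * b * c ≡ a * (2 * b * c)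
    rearrange = solve-∀

  size : m * K ! ≤ ∣ tabulate T ∣ * (K * L) ^ K
  size = begin
    m * K !                                   ≤⟨ proj₂ colouring ⟩
    count (λ i → rainbow c (E i)) * K ^ K     ≤⟨ *-monoˡ-≤ (K ^ K) shrink ⟩
    L ^ K * count T * K ^ K                   ≡⟨ xy∙z≈y∙zx (L ^ K) (count T) (K ^ K) ⟩
    count T * (K ^ K * L ^ K)                 ≡⟨ cong₂ _*_ (∣tabulate∣ T) (^-distribʳ-* K L K) ⟨
    ∣ tabulate T ∣ * (K * L) ^ K              ∎
    where open ≤-Reasoning

empty-IsPartite : ∀ {k m n} (edge : Fin m → Subset n) → IsPartite k edge ⊥ (λ _ → ⊥)
empty-IsPartite edge = (λ a b _ (w , w∈⊥∩⊥) → ∉⊥ (proj₁ (x∈p∩q⁻ ⊥ ⊥ w∈⊥∩⊥)))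
                     , (λ i i∈⊥ → ⊥-elim (∉⊥ i∈⊥))

empty-Balanced : ∀ {k m n} μ (edge : Fin m → Subset n) (S : Subset m) → Balanced k μ edge S (λ _ → ⊥)
empty-Balanced μ edge S a w w∈⊥ = ⊥-elim (∉⊥ w∈⊥)

Uniform⇒no-edges : ∀ {k m n} (edge : Fin m → Subset n) → Uniform k edge → n < k → m ≡ 0
Uniform⇒no-edges {m = zero}  edge uniform n<k = refl
Uniform⇒no-edges {m = suc m} edge uniform n<k =
  ⊥-elim (<-irrefl refl (<-≤-trans n<k (subst (_≤ _) (uniform zero) (∣p∣≤n (edge zero)))))

lemma2p2 : ∀ (k : ℕ) → 2 ≤ k → ∀ (n λ′ : ℕ) → IsCeilLog n λ′ →
    ∀ (m : ℕ) (edge : Fin m → Subset n) →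
    DistinctEdges edge → Uniform k edge → Linear edge →
    ∃₂ λ (S : Subset m) (X : Fin k → Subset n) →
      IsPartite k edge S X × Balanced k (2 * λ′ ^ k) edge S X ×
      m * k ! ≤ ∣ S ∣ * (k * λ′) ^ k
lemma2p2 1 (s≤s ())
lemma2p2 (suc (suc k)) 2≤k n zero (n≤e⁰ , _) m edge _ uniform _ =
  ⊥ , (λ _ → ⊥) , empty-IsPartite edge , empty-Balanced (2 * 0 ^ suc (suc k)) edge ⊥ ,
  ≤-trans (≤-reflexive (cong (_* _) (Uniform⇒no-edges edge uniform (≤-<-trans (ExpAtLeast-zero n≤e⁰) 2≤k)))) z≤n
lemma2p2 (suc (suc k)) 2≤k n (suc L′) (n≤eᴸ , _) m edge _ uniform linear =
  balanced-partite-subhypergraph L′ edge uniform λ w →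
    <-≤-trans (linear⇒degree< edge 2≤k uniform linear w) (ExpAtLeast⇒≤[2x]^x (suc L′) n≤eᴸ)
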